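{- Let $H$ be a Heyting algebra and let $x \# y$ be a term in the first-order language of Heyting algebras (built from variables $x,y$ and the operations $\wedge,\vee,\rightarrow,\bot,\top$) that is a tight apartness term in $H$. Then $H$ is a Boolean algebra.
   Context: A Heyting algebra is a bounded distributive lattice $\langle H,\wedge,\vee,\rightarrow,\bot,\top\rangle$ in which $a\rightarrow b$ is the largest $c$ with $a\wedge c\le b$; write $\neg a$ for $a\rightarrow\bot$. A term $x\# y$ in two free variables is an apartness term in $H$ if for all $x,y,z\in H$: (irreflexive) $x\#x=\bot$; (symmetric) $x\#y=y\#x$; (cotransitive) $x\#y\le (x\#z)\vee(z\#y)$. It is tight if in addition $\neg(x\#y)\wedge x\le y$ for all $x,y\in H$. -}

module Defs where

open import Level using (Level)
open import Relation.Binary.Lattice.Bundles using (HeytingAlgebra)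

data Term₂ : Set where
  varX varY : Term₂
  _∧ₜ_ _∨ₜ_ _⇒ₜ_ : Term₂ → Term₂ → Term₂
  ⊥ₜ ⊤ₜ : Term₂

module _ {c ℓ₁ ℓ₂ : Level} (H : HeytingAlgebra c ℓ₁ ℓ₂) where
  open HeytingAlgebra H

  neg : Carrier → Carrier
  neg a = a ⇨ ⊥

  ⟦_⟧ : Term₂ → Carrier → Carrier → Carrier
  ⟦ varX ⟧ a b = a
  ⟦ varY ⟧ a b = b
  ⟦ s ∧ₜ t ⟧ a b = ⟦ s ⟧ a b ∧ ⟦ t ⟧ a b
  ⟦ s ∨ₜ t ⟧ a b = ⟦ s ⟧ a b ∨ ⟦ t ⟧ a b
  ⟦ s ⇒ₜ t ⟧ a b = ⟦ s ⟧ a b ⇨ ⟦ t ⟧ a b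
  ⟦ ⊥ₜ ⟧ a b = ⊥
  ⟦ ⊤ₜ ⟧ a b = ⊤

  record IsApartnessTerm (t : Term₂) : Set (c Level.⊔ ℓ₁ Level.⊔ ℓ₂) where
    field
      irreflexive  : ∀ a → ⟦ t ⟧ a a ≈ ⊥
      symmetric    : ∀ a b → ⟦ t ⟧ a b ≈ ⟦ t ⟧ b a
      cotransitive : ∀ a b d → ⟦ t ⟧ a b ≤ (⟦ t ⟧ a d ∨ ⟦ t ⟧ d b)

  record IsTightApartnessTerm (t : Term₂) : Set (c Level.⊔ ℓ₁ Level.⊔ ℓ₂) where
    field
      isApartness : IsApartnessTerm t
      tight       : ∀ a b → (neg (⟦ t ⟧ a b) ∧ a) ≤ b

-- Modulo the filter generated by a, the elements a and ⊤ become equal, and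
-- every term function respects this congruence; hence
-- t(⊤, a) ∧ a ≤ t(a, a) = ⊥, i.e. t(⊤, a) ≤ ¬ a.  Tightness at (⊤, a) then
-- yields ¬ ¬ a ≤ ¬ t(⊤, a) ≤ a, and a Heyting algebra with double-negation
-- elimination is Boolean.
module Submission where

open import Defs
open import Level using (Level)
open import Data.Product using (_×_; _,_; proj₁; zip′; swap)
open import Relation.Binary.Lattice.Bundles using (HeytingAlgebra)
open import Relation.Binary.Lattice.Structures using (IsBooleanAlgebra)
import Relation.Binary.Lattice.Properties.HeytingAlgebra as HeytingAlgebraProperties
import Relation.Binary.Reasoning.PartialOrder as ≤-Reasoning

module _ {c ℓ₁ ℓ₂ : Level} (H : HeytingAlgebra c ℓ₁ ℓ₂) where
  open HeytingAlgebra H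
  open HeytingAlgebraProperties H
    using (¬_; ⇨-eval; swap-transpose-⇨; ⇨ʳ-covariant; ⇨ˡ-contravariant;
           y≤x⇨y; ∧-distribˡ-∨-≤; weak-lem)
  open import Relation.Binary.Lattice.Properties.JoinSemilattice joinSemilattice
    using (∨-monotonic)
  open import Relation.Binary.Lattice.Properties.MeetSemilattice meetSemilattice
    using (∧-monotonic)

  excluded-middle : (∀ x → ¬ ¬ x ≤ x) → ∀ x → ⊤ ≤ ¬ x ∨ x
  excluded-middle ¬¬-elim x = trans (reflexive (Eq.sym weak-lem)) (¬¬-elim _)

  ¬x∨y≤x⇨y : ∀ {x y} → ¬ x ∨ y ≤ x ⇨ y
  ¬x∨y≤x⇨y = ∨-least (⇨ʳ-covariant (minimum _)) y≤x⇨y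

  ¬¬-elim⇒isBooleanAlgebra : (∀ x → ¬ ¬ x ≤ x) →
                              IsBooleanAlgebra _≈_ _≤_ _∨_ _∧_ ¬_ ⊤ ⊥
  ¬¬-elim⇒isBooleanAlgebra ¬¬-elim = record { isHeytingAlgebra = record
    { isBoundedLattice = isBoundedLattice
    ; exponential      = λ w x y → curry , uncurry
    } }
    where
    curry : ∀ {w x y} → w ∧ x ≤ y → w ≤ ¬ x ∨ y
    curry {w} {x} {y} w∧x≤y = begin
      w                 ≤⟨ ∧-greatest refl (trans (maximum w) (excluded-middle ¬¬-elim x)) ⟩
      w ∧ (¬ x ∨ x)     ≤⟨ ∧-distribˡ-∨-≤ w (¬ x) x ⟩
      w ∧ ¬ x ∨ w ∧ x   ≤⟨ ∨-monotonic (x∧y≤y w (¬ x)) w∧x≤y ⟩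
      ¬ x ∨ y           ∎
      where open ≤-Reasoning poset

    uncurry : ∀ {w x y} → w ≤ ¬ x ∨ y → w ∧ x ≤ y
    uncurry w≤¬x∨y = transpose-∧ (trans w≤¬x∨y ¬x∨y≤x⇨y)

  -- b ≤[ a ] b' and b ≈[ a ] b' are the order and the equality of the
  -- quotient of H by the filter generated by a.

  infix 4 _≤[_]_ _≈[_]_

  _≤[_]_ : Carrier → Carrier → Carrier → Set ℓ₂
  b ≤[ a ] b′ = a ∧ b ≤ b′

  _≈[_]_ : Carrier → Carrier → Carrier → Set ℓ₂
  b ≈[ a ] b′ = b ≤[ a ] b′ × b′ ≤[ a ] b

  ∧-mono-≤[] : ∀ {a b b′ d d′} → b ≤[ a ] b′ → d ≤[ a ] d′ → b ∧ d ≤[ a ] b′ ∧ d′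
  ∧-mono-≤[] b≤b′ d≤d′ =
    ∧-greatest (trans (∧-monotonic refl (x∧y≤x _ _)) b≤b′)
               (trans (∧-monotonic refl (x∧y≤y _ _)) d≤d′)

  ∨-mono-≤[] : ∀ {a b b′ d d′} → b ≤[ a ] b′ → d ≤[ a ] d′ → b ∨ d ≤[ a ] b′ ∨ d′
  ∨-mono-≤[] {a} {b} {b′} {d} {d′} b≤b′ d≤d′ = begin
    a ∧ (b ∨ d)       ≤⟨ ∧-distribˡ-∨-≤ a b d ⟩
    a ∧ b ∨ a ∧ d     ≤⟨ ∨-monotonic b≤b′ d≤d′ ⟩
    b′ ∨ d′           ∎
    where open ≤-Reasoning poset

  ⇨-mono-≤[] : ∀ {a b b′ d d′} → b′ ≤[ a ] b → d ≤[ a ] d′ → b ⇨ d ≤[ a ] b′ ⇨ d′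
  ⇨-mono-≤[] {a} {b} {b′} {d} {d′} b′≤b d≤d′ = transpose-⇨ (begin
    (a ∧ (b ⇨ d)) ∧ b′   ≤⟨ ∧-greatest (trans (x∧y≤x _ _) (x∧y≤x _ _))
                                       (∧-monotonic (x∧y≤y _ _) refl) ⟩
    a ∧ ((b ⇨ d) ∧ b′)   ≤⟨ ∧-greatest (x∧y≤x _ _)
                                       (∧-greatest (trans (x∧y≤y _ _) (x∧y≤x _ _))
                                                   (trans (∧-monotonic refl (x∧y≤y _ _)) b′≤b)) ⟩
    a ∧ ((b ⇨ d) ∧ b)    ≤⟨ ∧-monotonic refl ⇨-eval ⟩
    a ∧ d                ≤⟨ d≤d′ ⟩
    d′                   ∎)
    where open ≤-Reasoning poset

  ⟦⟧-cong-≈[] : ∀ p {a b b′ d d′} → b ≈[ a ] b′ → d ≈[ a ] d′ →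
                ⟦_⟧ H p b d ≈[ a ] ⟦_⟧ H p b′ d′
  ⟦⟧-cong-≈[] varX     b≈b′ d≈d′ = b≈b′
  ⟦⟧-cong-≈[] varY     b≈b′ d≈d′ = d≈d′
  ⟦⟧-cong-≈[] (s ∧ₜ t) b≈b′ d≈d′ =
    zip′ ∧-mono-≤[] ∧-mono-≤[] (⟦⟧-cong-≈[] s b≈b′ d≈d′) (⟦⟧-cong-≈[] t b≈b′ d≈d′)
  ⟦⟧-cong-≈[] (s ∨ₜ t) b≈b′ d≈d′ =
    zip′ ∨-mono-≤[] ∨-mono-≤[] (⟦⟧-cong-≈[] s b≈b′ d≈d′) (⟦⟧-cong-≈[] t b≈b′ d≈d′)
  ⟦⟧-cong-≈[] (s ⇒ₜ t) b≈b′ d≈d′ =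
    zip′ ⇨-mono-≤[] ⇨-mono-≤[] (swap (⟦⟧-cong-≈[] s b≈b′ d≈d′)) (⟦⟧-cong-≈[] t b≈b′ d≈d′)
  ⟦⟧-cong-≈[] ⊥ₜ       b≈b′ d≈d′ = x∧y≤y _ _ , x∧y≤y _ _
  ⟦⟧-cong-≈[] ⊤ₜ       b≈b′ d≈d′ = x∧y≤y _ _ , x∧y≤y _ _

  ⊤≈[a]a : ∀ a → ⊤ ≈[ a ] a
  ⊤≈[a]a a = x∧y≤x a ⊤ , maximum _

  irreflexive∧tight⇒¬¬-elim : ∀ t → (∀ a → ⟦_⟧ H t a a ≈ ⊥) →
                              (∀ a b → ¬ ⟦_⟧ H t a b ∧ a ≤ b) →
                              ∀ a → ¬ ¬ a ≤ a
  irreflexive∧tight⇒¬¬-elim t irreflexive tight a = begin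
    ¬ ¬ a                 ≤⟨ ⇨ˡ-contravariant t[⊤,a]≤¬a ⟩
    ¬ ⟦_⟧ H t ⊤ a         ≤⟨ ∧-greatest refl (maximum _) ⟩
    ¬ ⟦_⟧ H t ⊤ a ∧ ⊤     ≤⟨ tight ⊤ a ⟩
    a                     ∎
    where
    open ≤-Reasoning poset
    t[⊤,a]≤¬a : ⟦_⟧ H t ⊤ a ≤ ¬ a
    t[⊤,a]≤¬a = swap-transpose-⇨
      (trans (proj₁ (⟦⟧-cong-≈[] t (⊤≈[a]a a) (x∧y≤y a a , x∧y≤y a a)))
             (reflexive (irreflexive a)))

mainTheorem1 : {c ℓ₁ ℓ₂ : Level} (H : HeytingAlgebra c ℓ₁ ℓ₂) (t : Term₂) →
    IsTightApartnessTerm H t →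
    IsBooleanAlgebra (HeytingAlgebra._≈_ H) (HeytingAlgebra._≤_ H) (HeytingAlgebra._∨_ H) (HeytingAlgebra._∧_ H) (neg H) (HeytingAlgebra.⊤ H) (HeytingAlgebra.⊥ H)
mainTheorem1 H t isTight = ¬¬-elim⇒isBooleanAlgebra H
  (irreflexive∧tight⇒¬¬-elim H t (IsApartnessTerm.irreflexive isApartness) tight)
  where open IsTightApartnessTerm isTight
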